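{- Let $G=(V,E)$ be a finite simple undirected graph, $t\ge 0$ an integer and $u\in V$. For each $v\in V\setminus(\{u\}\cup N(u))$ let $S_v$ be the unique minimum-size important $(u,v)$-separator, let $V_0$ be the set of those such $v$ with $|S_v|\le t$, and for $v\in V_0$ let $R(v)=R(v,S_v)$. Let $\mathcal{X}$ be the family of those sets $R(v)$, $v\in V_0$, that are inclusion-minimal, i.e. $R(v)\in\mathcal{X}$ iff there is no $w\in V_0$ with $R(w)\subsetneq R(v)$. Then any two distinct $A,B\in\mathcal{X}$ are disjoint.
   Context: $N(U)=\bigcup_{x\in U}N(x)\setminus U$ for $U\subseteq V$. For disjoint $X,Y\subseteq V$, a set $S\subseteq V\setminus(X\cup Y)$ is an $(X,Y)$-separator if $G-S$ has no path from $X$ to $Y$; it is minimal if no proper subset is an $(X,Y)$-separator. For $S$ and $X\subseteq V\setminus S$, $R(X,S)$ is the set of vertices reachable from $X$ in $G-S$. An $(X,Y)$-separator $T$ dominates an $(X,Y)$-separator $S$ if $|T|\le|S|$ and $R(X,S)\subsetneq R(X,T)$; $S$ is important if it is minimal and no $(X,Y)$-separator dominates it. Singletons $\{x\}$ are written $x$. It is known that if an $(X,Y)$-separator exists, there is exactly one important $(X,Y)$-separator of minimum size. -}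

module Defs where

open import Data.Nat using (ℕ; _≤_)
open import Data.Fin using (Fin)
open import Data.Fin.Subset using (Subset; _∈_; _∉_; _⊂_; ∣_∣)
open import Data.Product using (Σ; ∃; _×_; _,_)
open import Relation.Nullary using (¬_)
open import Data.Empty using (⊥)
open import Relation.Binary.PropositionalEquality using (_≡_)
open import Relation.Binary using (Decidable)

record Graph (n : ℕ) : Set₁ where
  field
    Adj     : Fin n → Fin n → Set
    adj-dec : Decidable Adj
    sym     : ∀ {x y} → Adj x y → Adj y x
    irrefl  : ∀ {x} → ¬ Adj x x
open Graph public

module _ {n : ℕ} (G : Graph n) where

  data Walk (S : Subset n) : Fin n → Fin n → Set where
    here : ∀ {x} → x ∉ S → Walk S x x
    step : ∀ {x y z} → x ∉ S → Adj G x y → Walk S y z → Walk S x z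

  VSet : Set₁
  VSet = Fin n → Set

  R : Fin n → Subset n → VSet
  R x S y = Walk S x y

  _⊆ᵖ_ : VSet → VSet → Set
  A ⊆ᵖ B = ∀ y → A y → B y

  _⊊ᵖ_ : VSet → VSet → Set
  A ⊊ᵖ B = A ⊆ᵖ B × ∃ λ y → B y × ¬ A y

  Disjoint : VSet → VSet → Set
  Disjoint A B = ∀ y → A y → B y → ⊥

  SameSet : VSet → VSet → Set
  SameSet A B = A ⊆ᵖ B × B ⊆ᵖ A

  IsSeparator : Fin n → Fin n → Subset n → Set
  IsSeparator u v S = u ∉ S × v ∉ S × ¬ Walk S u v

  IsMinimalSeparator : Fin n → Fin n → Subset n → Set
  IsMinimalSeparator u v S =
    IsSeparator u v S × (∀ S' → S' ⊂ S → ¬ IsSeparator u v S')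

  Dominates : Fin n → Fin n → Subset n → Subset n → Set
  Dominates u v T S =
    IsSeparator u v T × IsSeparator u v S × ∣ T ∣ ≤ ∣ S ∣ × (R u S ⊊ᵖ R u T)

  IsImportant : Fin n → Fin n → Subset n → Set
  IsImportant u v S =
    IsMinimalSeparator u v S × ¬ (∃ λ T → Dominates u v T S)

  IsMinImportant : Fin n → Fin n → Subset n → Set
  IsMinImportant u v S =
    IsImportant u v S × (∀ S' → IsImportant u v S' → ∣ S ∣ ≤ ∣ S' ∣)

  NonNeighbour : Fin n → Fin n → Set
  NonNeighbour u v = ¬ (u ≡ v) × ¬ Adj G u v

  InV0 : ℕ → Fin n → Fin n → Subset n → Set
  InV0 t u v S = NonNeighbour u v × IsMinImportant u v S × ∣ S ∣ ≤ t

  MinimalR : ℕ → Fin n → Fin n → Subset n → Set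
  MinimalR t u v S =
    ¬ (∃ λ w → ∃ λ Sw → InV0 t u w Sw × (R w Sw ⊊ᵖ R v S))

module Submission where

-- Call Z a shore for u and y if u ∈ Z and y ∉ Z ∪ N(Z). Then N(Z) separates u from y, and every
-- (u,y)-separator S contains N(Z) for the shore Z = R(u,S). Since Z ↦ |N(Z)| is submodular, among
-- the shores with |N(Z)| minimum the largest one, Z_y, absorbs every shore whose boundary is no larger;
-- N(Z_y) is the minimum important (u,y)-separator. If x ∈ R(v) ∩ R(w), then R(u,S_v) is a shore for x,
-- hence is absorbed by Z_x, so R(x, N(Z_x)) ⊆ R(v) and |N(Z_x)| ≤ |S_v| ≤ t. Thus x ∈ V₀ with
-- R(x) ⊆ R(v), likewise R(x) ⊆ R(w), and inclusion-minimality forces R(v) = R(x) = R(w).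

open import Defs hiding (sym)
open import Data.Bool.Properties using (T-≡)
open import Data.Nat using (ℕ; zero; suc; _+_; _≤_; _≤?_; _<?_)
open import Data.Nat.Properties
  using (≤-refl; ≤-trans; ≤-pred; <⇒≱; ≰⇒>; ≮⇒≥; n≮0; +-suc; +-comm; +-mono-≤; +-monoʳ-≤; +-cancelˡ-≤; m≤m+n; module ≤-Reasoning)
open import Data.Fin using (Fin)
open import Data.Fin.Properties using (any?)
open import Data.Fin.Subset using (Subset; _∈_; _∉_; _⊆_; _⊂_; ∣_∣; _∩_; _∪_; ∁; ⁅_⁆; inside; outside)
open import Data.Fin.Subset.Properties
  using (_∈?_; anySubset?; ⊆-trans; p⊆q⇒∣p∣≤∣q∣; p⊂q⇒∣p∣<∣q∣; ∣p∣≤n; p⊆q⇒∁p⊇∁q; x∈∁p⇒x∉p; x∉p⇒x∈∁p;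
         x∈⁅x⁆; x∈⁅y⁆⇒x≡y; p∩q⊆p; p∩q⊆q; x∈p∩q⁺; x∈p∩q⁻; p⊆p∪q; q⊆p∪q; x∈p∪q⁺; x∈p∪q⁻)
open import Data.Vec using ([]; _∷_; tabulate)
open import Data.Vec.Properties using ([]=⇒lookup; lookup⇒[]=; lookup∘tabulate)
open import Data.Product using (∃; ∃-syntax; _×_; _,_; proj₁; proj₂)
open import Data.Sum using (inj₁; inj₂; [_,_])
open import Data.Empty using (⊥-elim)
open import Function using (_∘_)
open import Function.Bundles using (Equivalence)
open import Relation.Nullary using (¬_; Dec; yes; no; contradiction)
open import Relation.Nullary.Decidable using (¬?; _×-dec_; isYes; toWitness; fromWitness; map′)
open import Relation.Unary using (Pred; Decidable)
open import Relation.Binary.PropositionalEquality using (_≡_; refl; sym; trans; cong)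

toSubset : ∀ {n ℓ} {P : Pred (Fin n) ℓ} → Decidable P → Subset n
toSubset P? = tabulate (isYes ∘ P?)

∈-toSubset⁺ : ∀ {n ℓ} {P : Pred (Fin n) ℓ} (P? : Decidable P) {i} → P i → i ∈ toSubset P?
∈-toSubset⁺ P? {i} p =
  lookup⇒[]= i _ (trans (lookup∘tabulate _ i) (Equivalence.to T-≡ (fromWitness {a? = P? i} p)))

∈-toSubset⁻ : ∀ {n ℓ} {P : Pred (Fin n) ℓ} (P? : Decidable P) {i} → i ∈ toSubset P? → P i
∈-toSubset⁻ P? {i} i∈ =
  toWitness {a? = P? i} (Equivalence.from T-≡ (trans (sym (lookup∘tabulate _ i)) ([]=⇒lookup i∈)))

+-suc-both : ∀ {a b c d} → a + b ≡ c + d → a + suc b ≡ c + suc d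
+-suc-both {a} {b} {c} {d} eq = trans (+-suc a b) (trans (cong suc eq) (sym (+-suc c d)))

∣p∩q∣+∣p∪q∣≡∣p∣+∣q∣ : ∀ {n} (p q : Subset n) → ∣ p ∩ q ∣ + ∣ p ∪ q ∣ ≡ ∣ p ∣ + ∣ q ∣
∣p∩q∣+∣p∪q∣≡∣p∣+∣q∣ []            []            = refl
∣p∩q∣+∣p∪q∣≡∣p∣+∣q∣ (inside ∷ p)  (inside ∷ q)  = cong suc (+-suc-both (∣p∩q∣+∣p∪q∣≡∣p∣+∣q∣ p q))
∣p∩q∣+∣p∪q∣≡∣p∣+∣q∣ (inside ∷ p)  (outside ∷ q) = trans (+-suc _ _) (cong suc (∣p∩q∣+∣p∪q∣≡∣p∣+∣q∣ p q))
∣p∩q∣+∣p∪q∣≡∣p∣+∣q∣ (outside ∷ p) (inside ∷ q)  = +-suc-both (∣p∩q∣+∣p∪q∣≡∣p∣+∣q∣ p q)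
∣p∩q∣+∣p∪q∣≡∣p∣+∣q∣ (outside ∷ p) (outside ∷ q) = ∣p∩q∣+∣p∪q∣≡∣p∣+∣q∣ p q

∣p∣+∣q∣≤∣r∣+∣s∣ : ∀ {n} {p q r s : Subset n} → p ∩ q ⊆ r ∩ s → p ∪ q ⊆ r ∪ s → ∣ p ∣ + ∣ q ∣ ≤ ∣ r ∣ + ∣ s ∣
∣p∣+∣q∣≤∣r∣+∣s∣ {p = p} {q} {r} {s} ∩⊆∩ ∪⊆∪ = begin
  ∣ p ∣ + ∣ q ∣          ≡⟨ sym (∣p∩q∣+∣p∪q∣≡∣p∣+∣q∣ p q) ⟩
  ∣ p ∩ q ∣ + ∣ p ∪ q ∣  ≤⟨ +-mono-≤ (p⊆q⇒∣p∣≤∣q∣ ∩⊆∩) (p⊆q⇒∣p∣≤∣q∣ ∪⊆∪) ⟩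
  ∣ r ∩ s ∣ + ∣ r ∪ s ∣  ≡⟨ ∣p∩q∣+∣p∪q∣≡∣p∣+∣q∣ r s ⟩
  ∣ r ∣ + ∣ s ∣          ∎
  where open ≤-Reasoning

p⊆q⇒∣q∣≤∣p∣⇒q⊆p : ∀ {n} {p q : Subset n} → p ⊆ q → ∣ q ∣ ≤ ∣ p ∣ → q ⊆ p
p⊆q⇒∣q∣≤∣p∣⇒q⊆p {p = p} p⊆q ∣q∣≤∣p∣ {i} i∈q with i ∈? p
... | yes i∈p = i∈p
... | no i∉p  = contradiction ∣q∣≤∣p∣ (<⇒≱ (p⊂q⇒∣p∣<∣q∣ (p⊆q , i , i∈q , i∉p)))

p⊆q⇒∣∁p∣≤∣∁q∣⇒q⊆p : ∀ {n} {p q : Subset n} → p ⊆ q → ∣ ∁ p ∣ ≤ ∣ ∁ q ∣ → q ⊆ p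
p⊆q⇒∣∁p∣≤∣∁q∣⇒q⊆p {p = p} p⊆q ∣∁p∣≤∣∁q∣ {i} i∈q with i ∈? p
... | yes i∈p = i∈p
... | no i∉p  =
  contradiction i∈q (x∈∁p⇒x∉p (p⊆q⇒∣q∣≤∣p∣⇒q⊆p (p⊆q⇒∁p⊇∁q p⊆q) ∣∁p∣≤∣∁q∣ (x∉p⇒x∈∁p i∉p)))

argmin : ∀ {n ℓ} {P : Pred (Subset n) ℓ} → Decidable P → (f : Subset n → ℕ) →
         ∀ {p} → P p → ∃[ q ] P q × (∀ r → P r → f q ≤ f r)
argmin {P = P} P? f {p} Pp = descend (f p) Pp ≤-refl
  where
  descend : ∀ k {p} → P p → f p ≤ k → ∃[ q ] P q × (∀ r → P r → f q ≤ f r)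
  descend k {p} Pp fp≤k with anySubset? (λ r → P? r ×-dec f r <? f p)
  ... | no ∄smaller = p , Pp , λ r Pr → ≮⇒≥ (λ fr<fp → ∄smaller (r , Pr , fr<fp))
  descend zero    Pp fp≤0 | yes (r , Pr , fr<fp) = contradiction (≤-trans fr<fp fp≤0) n≮0
  descend (suc k) Pp fp≤k | yes (r , Pr , fr<fp) = descend k Pr (≤-pred (≤-trans fr<fp fp≤k))

module Separation {n : ℕ} (G : Graph n) where

  source∉ : ∀ {S x y} → Walk G S x y → x ∉ S
  source∉ (here x∉S)     = x∉S
  source∉ (step x∉S _ _) = x∉S

  target∉ : ∀ {S x y} → Walk G S x y → y ∉ S
  target∉ (here y∉S)   = y∉S
  target∉ (step _ _ w) = target∉ w

  snoc : ∀ {S x y z} → Walk G S x y → Adj G y z → z ∉ S → Walk G S x z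
  snoc (here y∉S)     y~z z∉S = step y∉S y~z (here z∉S)
  snoc (step x∉S e w) y~z z∉S = step x∉S e (snoc w y~z z∉S)

  _++_ : ∀ {S x y z} → Walk G S x y → Walk G S y z → Walk G S x z
  here _       ++ w′ = w′
  step x∉S e w ++ w′ = step x∉S e (w ++ w′)

  reverse : ∀ {S x y} → Walk G S x y → Walk G S y x
  reverse (here x∉S)     = here x∉S
  reverse (step x∉S e w) = snoc (reverse w) (Graph.sym G e) x∉S

  walk-preserves : ∀ {S} (P : Fin n → Set) → (∀ {a b} → P a → Adj G a b → b ∉ S → P b) →
                   ∀ {x y} → Walk G S x y → P x → P y
  walk-preserves P closed (here _)     Px = Px
  walk-preserves P closed (step _ e w) Px = walk-preserves P closed w (closed Px e (source∉ w))

  walk-restrict : ∀ {S T x y} → (∀ {z} → Walk G S x z → z ∉ T) → Walk G S x y → Walk G T x y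
  walk-restrict avoids (here x∉S)     = here (avoids (here x∉S))
  walk-restrict avoids (step x∉S e w) = step (avoids (here x∉S)) e (walk-restrict (avoids ∘ step x∉S e) w)

  neighbour? : ∀ Z → Decidable (λ y → y ∉ Z × ∃[ z ] z ∈ Z × Adj G z y)
  neighbour? Z y = ¬? (y ∈? Z) ×-dec any? (λ z → z ∈? Z ×-dec adj-dec G z y)

  -- Opaque so that unification never unfolds ∣ N Z ∣ into a count over a tabulated vector.
  opaque
    N : Subset n → Subset n
    N Z = toSubset (neighbour? Z)

    ∈-N⁺ : ∀ {Z y z} → y ∉ Z → z ∈ Z → Adj G z y → y ∈ N Z
    ∈-N⁺ {Z} y∉Z z∈Z z~y = ∈-toSubset⁺ (neighbour? Z) (y∉Z , _ , z∈Z , z~y)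

    ∈-N⁻ : ∀ {Z y} → y ∈ N Z → y ∉ Z × ∃[ z ] z ∈ Z × Adj G z y
    ∈-N⁻ {Z} = ∈-toSubset⁻ (neighbour? Z)

  ∈⇒∉N : ∀ {Z y} → y ∈ Z → y ∉ N Z
  ∈⇒∉N y∈Z y∈NZ = proj₁ (∈-N⁻ y∈NZ) y∈Z

  ∈N-mono : ∀ {Z Z′ y} → Z ⊆ Z′ → y ∈ N Z → y ∉ Z′ → y ∈ N Z′
  ∈N-mono Z⊆Z′ y∈NZ y∉Z′ with ∈-N⁻ y∈NZ
  ... | _ , z , z∈Z , z~y = ∈-N⁺ y∉Z′ (Z⊆Z′ z∈Z) z~y

  N-∩⊆ : ∀ Z₁ Z₂ → N (Z₁ ∩ Z₂) ⊆ N Z₁ ∪ N Z₂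
  N-∩⊆ Z₁ Z₂ {y} y∈N with y ∈? Z₁
  ... | no y∉Z₁  = x∈p∪q⁺ (inj₁ (∈N-mono (p∩q⊆p Z₁ Z₂) y∈N y∉Z₁))
  ... | yes y∈Z₁ = x∈p∪q⁺ (inj₂ (∈N-mono (p∩q⊆q Z₁ Z₂) y∈N λ y∈Z₂ → ∈⇒∉N (x∈p∩q⁺ (y∈Z₁ , y∈Z₂)) y∈N))

  N-∪⊆ : ∀ Z₁ Z₂ → N (Z₁ ∪ Z₂) ⊆ N Z₁ ∪ N Z₂
  N-∪⊆ Z₁ Z₂ y∈N with ∈-N⁻ y∈N
  ... | y∉Z₁∪Z₂ , z , z∈Z₁∪Z₂ , z~y with x∈p∪q⁻ Z₁ Z₂ z∈Z₁∪Z₂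
  ...   | inj₁ z∈Z₁ = x∈p∪q⁺ (inj₁ (∈-N⁺ (y∉Z₁∪Z₂ ∘ p⊆p∪q Z₂) z∈Z₁ z~y))
  ...   | inj₂ z∈Z₂ = x∈p∪q⁺ (inj₂ (∈-N⁺ (y∉Z₁∪Z₂ ∘ q⊆p∪q Z₁ Z₂) z∈Z₂ z~y))

  N-∩∪⊆ : ∀ Z₁ Z₂ → N (Z₁ ∩ Z₂) ∩ N (Z₁ ∪ Z₂) ⊆ N Z₁ ∩ N Z₂
  N-∩∪⊆ Z₁ Z₂ {y} y∈ with x∈p∩q⁻ (N (Z₁ ∩ Z₂)) _ y∈
  ... | y∈N∩ , y∈N∪ = x∈p∩q⁺ (widen (p∩q⊆p Z₁ Z₂) (p⊆p∪q Z₂) , widen (p∩q⊆q Z₁ Z₂) (q⊆p∪q Z₁ Z₂))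
    where
    widen : ∀ {Z} → Z₁ ∩ Z₂ ⊆ Z → Z ⊆ Z₁ ∪ Z₂ → y ∈ N Z
    widen ∩⊆Z Z⊆∪ = ∈N-mono ∩⊆Z y∈N∩ (proj₁ (∈-N⁻ y∈N∪) ∘ Z⊆∪)

  N-submodular : ∀ Z₁ Z₂ → ∣ N (Z₁ ∩ Z₂) ∣ + ∣ N (Z₁ ∪ Z₂) ∣ ≤ ∣ N Z₁ ∣ + ∣ N Z₂ ∣
  N-submodular Z₁ Z₂ =
    ∣p∣+∣q∣≤∣r∣+∣s∣ (N-∩∪⊆ Z₁ Z₂) (λ y∈ → [ N-∩⊆ Z₁ Z₂ , N-∪⊆ Z₁ Z₂ ] (x∈p∪q⁻ (N (Z₁ ∩ Z₂)) _ y∈))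

  walk-stays-in : ∀ {Z x y} → Walk G (N Z) x y → x ∈ Z → y ∈ Z
  walk-stays-in {Z} = walk-preserves (_∈ Z) enter
    where
    enter : ∀ {a b} → a ∈ Z → Adj G a b → b ∉ N Z → b ∈ Z
    enter {b = b} a∈Z a~b b∉NZ with b ∈? Z
    ... | yes b∈Z = b∈Z
    ... | no b∉Z  = contradiction (∈-N⁺ b∉Z a∈Z a~b) b∉NZ

  walk-stays-out : ∀ {Z x y} → Walk G (N Z) x y → x ∉ Z → y ∉ Z
  walk-stays-out w x∉Z y∈Z = x∉Z (walk-stays-in (reverse w) y∈Z)

  module _ (S : Subset n) where

    grow : Subset n → Subset n
    grow Z = Z ∪ (N Z ∩ ∁ S)

    -- Each round either stops or adds a vertex, so n rounds reach a set closed under grow.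
    closure : ℕ → Subset n → Subset n
    closure zero    Z = Z
    closure (suc k) Z with ∣ grow Z ∣ ≤? ∣ Z ∣
    ... | yes _ = Z
    ... | no _  = closure k (grow Z)

    ⊆-closure : ∀ k Z → Z ⊆ closure k Z
    ⊆-closure zero    Z = λ i∈Z → i∈Z
    ⊆-closure (suc k) Z with ∣ grow Z ∣ ≤? ∣ Z ∣
    ... | yes _ = λ i∈Z → i∈Z
    ... | no _  = ⊆-trans (p⊆p∪q _) (⊆-closure k (grow Z))

    closure-closed : ∀ k Z → n ≤ k + ∣ Z ∣ → grow (closure k Z) ⊆ closure k Z
    closure-closed zero    Z n≤∣Z∣ = p⊆q⇒∣q∣≤∣p∣⇒q⊆p (p⊆p∪q _) (≤-trans (∣p∣≤n (grow Z)) n≤∣Z∣)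
    closure-closed (suc k) Z n≤ with ∣ grow Z ∣ ≤? ∣ Z ∣
    ... | yes ∣grow∣≤ = p⊆q⇒∣q∣≤∣p∣⇒q⊆p (p⊆p∪q _) ∣grow∣≤
    ... | no ∣grow∣≰  = closure-closed k (grow Z) (begin
      n               ≤⟨ n≤ ⟩
      suc k + ∣ Z ∣   ≡⟨ +-suc k _ ⟨
      k + suc ∣ Z ∣   ≤⟨ +-monoʳ-≤ k (≰⇒> ∣grow∣≰) ⟩
      k + ∣ grow Z ∣  ∎)
      where open ≤-Reasoning

    closure-walks : ∀ {x} k Z → (∀ {i} → i ∈ Z → Walk G S x i) → ∀ {i} → i ∈ closure k Z → Walk G S x i
    closure-walks zero    Z walks = walks
    closure-walks (suc k) Z walks with ∣ grow Z ∣ ≤? ∣ Z ∣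
    ... | yes _ = walks
    ... | no _  = closure-walks k (grow Z) grow-walks
      where
      grow-walks : ∀ {i} → i ∈ grow Z → Walk G S _ i
      grow-walks i∈grow with x∈p∪q⁻ Z _ i∈grow
      ... | inj₁ i∈Z     = walks i∈Z
      ... | inj₂ i∈N∖S with x∈p∩q⁻ (N Z) _ i∈N∖S
      ...   | i∈NZ , i∈∁S with ∈-N⁻ i∈NZ
      ...     | _ , z , z∈Z , z~i = snoc (walks z∈Z) z~i (x∈∁p⇒x∉p i∈∁S)

    reach : Fin n → Subset n
    reach x = closure n (⁅ x ⁆ ∩ ∁ S)

    ∈-reach⁻ : ∀ {x y} → y ∈ reach x → Walk G S x y
    ∈-reach⁻ {x} = closure-walks n _ start
      where
      start : ∀ {i} → i ∈ ⁅ x ⁆ ∩ ∁ S → Walk G S x i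
      start {i} i∈ with x∈p∩q⁻ ⁅ x ⁆ _ i∈
      ... | i∈⁅x⁆ , i∈∁S with x∈⁅y⁆⇒x≡y x i∈⁅x⁆
      ...   | refl = here (x∈∁p⇒x∉p i∈∁S)

    ∈-reach⁺ : ∀ {x y} → Walk G S x y → y ∈ reach x
    ∈-reach⁺ {x} w = walk-preserves (_∈ reach x) extend w
      (⊆-closure n _ (x∈p∩q⁺ (x∈⁅x⁆ x , x∉p⇒x∈∁p (source∉ w))))
      where
      extend : ∀ {a b} → a ∈ reach x → Adj G a b → b ∉ S → b ∈ reach x
      extend {b = b} a∈ a~b b∉S with b ∈? reach x
      ... | yes b∈ = b∈
      ... | no b∉  = closure-closed n _ (m≤m+n n _)
                       (x∈p∪q⁺ (inj₂ (x∈p∩q⁺ (∈-N⁺ b∉ a∈ a~b , x∉p⇒x∈∁p b∉S))))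

    walk? : ∀ x y → Dec (Walk G S x y)
    walk? x y = map′ ∈-reach⁻ ∈-reach⁺ (y ∈? reach x)

    N-reach⊆ : ∀ x → N (reach x) ⊆ S
    N-reach⊆ x {b} b∈N with b ∈? S | ∈-N⁻ b∈N
    ... | yes b∈S | _                     = b∈S
    ... | no b∉S  | b∉ , a , a∈ , a~b = contradiction (∈-reach⁺ (snoc (∈-reach⁻ a∈) a~b b∉S)) b∉

  separator⇒nonNeighbour : ∀ {u x S} → IsSeparator G u x S → NonNeighbour G u x
  separator⇒nonNeighbour (u∉S , x∉S , ¬u⇝x) =
    (λ { refl → ¬u⇝x (here u∉S) }) , λ u~x → ¬u⇝x (step u∉S u~x (here x∉S))

  separator-along : ∀ {u v x S} → IsSeparator G u v S → Walk G S v x → IsSeparator G u x S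
  separator-along (u∉S , _ , ¬u⇝v) v⇝x = u∉S , target∉ v⇝x , λ u⇝x → ¬u⇝v (u⇝x ++ reverse v⇝x)

  minImportant⇒separator : ∀ {u v S} → IsMinImportant G u v S → IsSeparator G u v S
  minImportant⇒separator = proj₁ ∘ proj₁ ∘ proj₁

  module _ (u : Fin n) where

    Shore : Fin n → Subset n → Set
    Shore y Z = u ∈ Z × y ∉ Z × y ∉ N Z

    shore? : ∀ y → Decidable (Shore y)
    shore? y Z = u ∈? Z ×-dec ¬? (y ∈? Z) ×-dec ¬? (y ∈? N Z)

    shore⇒separator : ∀ {y Z} → Shore y Z → IsSeparator G u y (N Z)
    shore⇒separator (u∈Z , y∉Z , y∉NZ) = ∈⇒∉N u∈Z , y∉NZ , λ u⇝y → y∉Z (walk-stays-in u⇝y u∈Z)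

    separator⇒shore : ∀ {y S} → IsSeparator G u y S → Shore y (reach S u)
    separator⇒shore {S = S} (u∉S , y∉S , ¬u⇝y) =
      ∈-reach⁺ S (here u∉S) , ¬u⇝y ∘ ∈-reach⁻ S , y∉S ∘ N-reach⊆ S u

    shore-∪ : ∀ {y Z₁ Z₂} → Shore y Z₁ → Shore y Z₂ → Shore y (Z₁ ∪ Z₂)
    shore-∪ {Z₁ = Z₁} {Z₂} (u∈Z₁ , y∉Z₁ , y∉NZ₁) (_ , y∉Z₂ , y∉NZ₂) =
      x∈p∪q⁺ (inj₁ u∈Z₁) ,
      [ y∉Z₁ , y∉Z₂ ] ∘ x∈p∪q⁻ Z₁ Z₂ ,
      [ y∉NZ₁ , y∉NZ₂ ] ∘ x∈p∪q⁻ (N Z₁) (N Z₂) ∘ N-∪⊆ Z₁ Z₂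

    shore-∩ : ∀ {y Z₁ Z₂} → u ∈ Z₁ → Shore y Z₂ → Shore y (Z₁ ∩ Z₂)
    shore-∩ {Z₁ = Z₁} {Z₂} u∈Z₁ (u∈Z₂ , y∉Z₂ , y∉NZ₂) =
      x∈p∩q⁺ (u∈Z₁ , u∈Z₂) ,
      y∉Z₂ ∘ p∩q⊆q Z₁ Z₂ ,
      λ y∈N → y∉NZ₂ (∈N-mono (p∩q⊆q Z₁ Z₂) y∈N y∉Z₂)

    record ExtremalShore (y : Fin n) (Z : Subset n) : Set where
      field
        shore     : Shore y Z
        N-minimum : ∀ {Z′} → Shore y Z′ → ∣ N Z ∣ ≤ ∣ N Z′ ∣
        maximal   : ∀ {Z′} → Shore y Z′ → ∣ N Z′ ∣ ≤ ∣ N Z ∣ → Z ⊆ Z′ → Z′ ⊆ Z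

    extremalShore : ∀ {y Z} → Shore y Z → ∃ (ExtremalShore y)
    extremalShore {y} shore-Z with argmin (shore? y) (∣_∣ ∘ N) shore-Z
    ... | Z₁ , shore-Z₁ , N-Z₁-minimum
        with argmin (λ Z′ → shore? y Z′ ×-dec ∣ N Z′ ∣ ≤? ∣ N Z₁ ∣) (∣_∣ ∘ ∁) (shore-Z₁ , ≤-refl)
    ...   | Z₂ , (shore , ∣NZ₂∣≤∣NZ₁∣) , ∁Z₂-minimum = Z₂ , record
      { shore     = shore
      ; N-minimum = λ shore′ → ≤-trans ∣NZ₂∣≤∣NZ₁∣ (N-Z₁-minimum _ shore′)
      ; maximal   = λ shore′ ∣NZ′∣≤ Z⊆Z′ →
          p⊆q⇒∣∁p∣≤∣∁q∣⇒q⊆p Z⊆Z′ (∁Z₂-minimum _ (shore′ , ≤-trans ∣NZ′∣≤ ∣NZ₂∣≤∣NZ₁∣))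
      }

    extremal-absorbs : ∀ {y Z Z′} → ExtremalShore y Z → Shore y Z′ → ∣ N Z′ ∣ ≤ ∣ N (Z ∩ Z′) ∣ → Z′ ⊆ Z
    extremal-absorbs {Z = Z} {Z′} extremal shore′ ∣NZ′∣≤ =
      ⊆-trans (q⊆p∪q Z Z′) (maximal (shore-∪ shore shore′) ∣N∪∣≤∣NZ∣ (p⊆p∪q Z′))
      where
      open ExtremalShore extremal
      ∣N∪∣≤∣NZ∣ : ∣ N (Z ∪ Z′) ∣ ≤ ∣ N Z ∣
      ∣N∪∣≤∣NZ∣ = +-cancelˡ-≤ ∣ N (Z ∩ Z′) ∣ _ _ (begin
        ∣ N (Z ∩ Z′) ∣ + ∣ N (Z ∪ Z′) ∣  ≤⟨ N-submodular Z Z′ ⟩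
        ∣ N Z ∣ + ∣ N Z′ ∣              ≤⟨ +-monoʳ-≤ ∣ N Z ∣ ∣NZ′∣≤ ⟩
        ∣ N Z ∣ + ∣ N (Z ∩ Z′) ∣        ≡⟨ +-comm ∣ N Z ∣ _ ⟩
        ∣ N (Z ∩ Z′) ∣ + ∣ N Z ∣        ∎)
        where open ≤-Reasoning

    extremal⇒minImportant : ∀ {y Z} → ExtremalShore y Z → IsMinImportant G u y (N Z)
    extremal⇒minImportant {y} {Z} extremal =
      ((shore⇒separator shore , minimal) , undominated) , λ S ((S-separates , _) , _) → ∣NZ∣≤ S-separates
      where
      open ExtremalShore extremal
      ∣NZ∣≤ : ∀ {S} → IsSeparator G u y S → ∣ N Z ∣ ≤ ∣ S ∣
      ∣NZ∣≤ {S} S-separates = ≤-trans (N-minimum (separator⇒shore S-separates)) (p⊆q⇒∣p∣≤∣q∣ (N-reach⊆ S u))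
      minimal : ∀ S → S ⊂ N Z → ¬ IsSeparator G u y S
      minimal S S⊂NZ S-separates = <⇒≱ (p⊂q⇒∣p∣<∣q∣ S⊂NZ) (∣NZ∣≤ S-separates)
      undominated : ¬ ∃ λ T → Dominates G u y T (N Z)
      undominated (T , T-separates , _ , ∣T∣≤ , _ , z , u⇝z , ¬u⇝z) = ¬u⇝z (walk-restrict avoids u⇝z)
        where
        reach⊆Z : reach T u ⊆ Z
        reach⊆Z = extremal-absorbs extremal (separator⇒shore T-separates)
          (≤-trans (p⊆q⇒∣p∣≤∣q∣ (N-reach⊆ T u))
          (≤-trans ∣T∣≤ (N-minimum (shore-∩ (proj₁ shore) (separator⇒shore T-separates)))))
        avoids : ∀ {a} → Walk G T u a → a ∉ N Z
        avoids = ∈⇒∉N ∘ reach⊆Z ∘ ∈-reach⁺ T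

    minImportant≤N : ∀ {y S Z} → IsMinImportant G u y S → Shore y Z → ∣ S ∣ ≤ ∣ N Z ∣
    minImportant≤N (_ , S-least) shore-Z with extremalShore shore-Z
    ... | Z* , extremal =
      ≤-trans (S-least (N Z*) (proj₁ (extremal⇒minImportant extremal))) (ExtremalShore.N-minimum extremal shore-Z)

    extremal-inside : ∀ {t v S x Z} → InV0 G t u v S → Walk G S v x → ExtremalShore x Z →
                      InV0 G t u x (N Z) × _⊆ᵖ_ G (R G x (N Z)) (R G v S)
    extremal-inside {t} {v} {S} {x} {Z} (_ , S-minImportant , ∣S∣≤t) v⇝x extremal =
      (separator⇒nonNeighbour x-separated , extremal⇒minImportant extremal , ∣NZ∣≤t) , X⊆A
      where
      open ExtremalShore extremal
      D : Subset n
      D = reach S u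
      S-separates : IsSeparator G u v S
      S-separates = minImportant⇒separator S-minImportant
      x-separated : IsSeparator G u x S
      x-separated = separator-along S-separates v⇝x
      shore-v : Shore v D
      shore-v = separator⇒shore S-separates
      shore-x : Shore x D
      shore-x = separator⇒shore x-separated
      ∣ND∣≤∣S∣ : ∣ N D ∣ ≤ ∣ S ∣
      ∣ND∣≤∣S∣ = p⊆q⇒∣p∣≤∣q∣ (N-reach⊆ S u)
      ∣NZ∣≤t : ∣ N Z ∣ ≤ t
      ∣NZ∣≤t = ≤-trans (N-minimum shore-x) (≤-trans ∣ND∣≤∣S∣ ∣S∣≤t)
      S⊆ND : S ⊆ N D
      S⊆ND = p⊆q⇒∣q∣≤∣p∣⇒q⊆p (N-reach⊆ S u) (minImportant≤N S-minImportant shore-v)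
      D⊆Z : D ⊆ Z
      D⊆Z = extremal-absorbs extremal shore-x
        (≤-trans ∣ND∣≤∣S∣ (minImportant≤N S-minImportant (shore-∩ (proj₁ shore) shore-v)))
      avoids : ∀ {a} → Walk G (N Z) x a → a ∉ S
      avoids x⇝a a∈S =
        target∉ x⇝a (∈N-mono D⊆Z (S⊆ND a∈S) (walk-stays-out x⇝a (proj₁ (proj₂ shore))))
      X⊆A : _⊆ᵖ_ G (R G x (N Z)) (R G v S)
      X⊆A _ x⇝z = v⇝x ++ walk-restrict avoids x⇝z

    minimalR⇒⊇ : ∀ {t v S x T} → MinimalR G t u v S → InV0 G t u x T →
                 _⊆ᵖ_ G (R G x T) (R G v S) → _⊆ᵖ_ G (R G v S) (R G x T)
    minimalR⇒⊇ {x = x} {T} minimal x∈V₀ X⊆A z v⇝z with walk? T x z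
    ... | yes x⇝z = x⇝z
    ... | no ¬x⇝z = ⊥-elim (minimal (x , T , x∈V₀ , X⊆A , z , v⇝z , ¬x⇝z))

lemma4 : ∀ {n : ℕ} (G : Graph n) (t : ℕ) (u : Fin n)
         (v w : Fin n) (Sv Sw : Subset n) →
         InV0 G t u v Sv → InV0 G t u w Sw →
         MinimalR G t u v Sv → MinimalR G t u w Sw →
         ¬ SameSet G (R G v Sv) (R G w Sw) →
         Disjoint G (R G v Sv) (R G w Sw)
lemma4 G t u v w Sv Sw v∈V₀ w∈V₀ minimal-v minimal-w A≠B x v⇝x w⇝x =
  A≠B ((λ z → X⊆B z ∘ A⊆X z) , (λ z → X⊆A z ∘ B⊆X z))
  where
  open Separation G
  x-separated : IsSeparator G u x Sv
  x-separated = separator-along (minImportant⇒separator (proj₁ (proj₂ v∈V₀))) v⇝x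
  Z : Subset _
  Z = proj₁ (extremalShore u (separator⇒shore u x-separated))
  extremal : ExtremalShore u x Z
  extremal = proj₂ (extremalShore u (separator⇒shore u x-separated))
  x∈V₀ : InV0 G t u x (N Z)
  x∈V₀ = proj₁ (extremal-inside u v∈V₀ v⇝x extremal)
  X⊆A : _⊆ᵖ_ G (R G x (N Z)) (R G v Sv)
  X⊆A = proj₂ (extremal-inside u v∈V₀ v⇝x extremal)
  X⊆B : _⊆ᵖ_ G (R G x (N Z)) (R G w Sw)
  X⊆B = proj₂ (extremal-inside u w∈V₀ w⇝x extremal)
  A⊆X : _⊆ᵖ_ G (R G v Sv) (R G x (N Z))
  A⊆X = minimalR⇒⊇ u minimal-v x∈V₀ X⊆A
  B⊆X : _⊆ᵖ_ G (R G w Sw) (R G x (N Z))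
  B⊆X = minimalR⇒⊇ u minimal-w x∈V₀ X⊆B
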